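{- Let $G=(V,E)$ be a simple, nontrivial (at least two vertices), connected graph. Then $\gamma_{V,E}(G)\ge\gamma'(G)$, $\gamma_{V,E}(G)\ge\gamma''(G)$, $\gamma_{V,E}(G)\ge\gamma(G)$, $\gamma_{E,V}(G)\ge\gamma'(G)$, $\gamma_{E,V}(G)\ge\gamma''(G)$, $\gamma_{E,V}(G)\ge\gamma(G)$, $\gamma''(G)\ge\gamma'(G)$, and $\gamma''(G)\ge\gamma(G)$.
   Context: An element of a graph $G=(V,E)$ is a member of $V\cup E$. Two different elements are associated if they are adjacent (two adjacent vertices, or two edges sharing an end-vertex) or incident (a vertex and an edge containing it). For $U,W\in\{V,E,V\cup E\}$, a subset $A\subseteq U$ dominates $W$ if every element of $W\setminus(A\cap W)$ is associated with some element of $A$; $\gamma_{U,W}(G)$ denotes the minimum cardinality of a subset $A\subseteq U$ dominating $W$. Notation: $\gamma(G)=\gamma_{V,V}(G)$, $\gamma'(G)=\gamma_{E,E}(G)$, $\gamma''(G)=\gamma_{V\cup E,V\cup E}(G)$. -}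

module Defs where

open import Data.Nat using (ℕ; _≤_)
open import Data.Fin using (Fin) renaming (_<_ to _<ᶠ_)
open import Data.Bool using (Bool; true; false; T)
open import Data.Product using (Σ; ∃; _×_; _,_; proj₁; proj₂)
open import Data.Sum using (_⊎_)
open import Data.Unit using (⊤)
open import Data.Empty using (⊥)
open import Data.List using (List; length)
open import Data.List.Membership.Propositional using (_∈_)
open import Data.List.Relation.Unary.All using (All)
open import Data.List.Relation.Unary.Unique.Propositional using (Unique)
open import Relation.Binary.PropositionalEquality using (_≡_; _≢_)

record Graph : Set where
  field
    n     : ℕ
    adj   : Fin n → Fin n → Bool
    sym   : ∀ u v → adj u v ≡ adj v u
    irrefl : ∀ v → adj v v ≡ false

module _ (G : Graph) where
  open Graph G

  -- An edge {u,v} is represented canonically by its endpoints u < v.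
  Edge : Set
  Edge = Σ (Fin n × Fin n) λ p → (proj₁ p <ᶠ proj₂ p) × T (adj (proj₁ p) (proj₂ p))

  EndOf : Fin n → Edge → Set
  EndOf v e = (v ≡ proj₁ (proj₁ e)) ⊎ (v ≡ proj₂ (proj₁ e))

  data Elem : Set where
    vtx : Fin n → Elem
    edg : Edge → Elem

  data Assoc : Elem → Elem → Set where
    vv : ∀ {u v} → T (adj u v) → Assoc (vtx u) (vtx v)
    ee : ∀ {e f} → e ≢ f → (∃ λ v → EndOf v e × EndOf v f) → Assoc (edg e) (edg f)
    ve : ∀ {v e} → EndOf v e → Assoc (vtx v) (edg e)
    ev : ∀ {v e} → EndOf v e → Assoc (edg e) (vtx v)

data Kind : Set where
  V E VE : Kind

module _ {G : Graph} where
  open Graph G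

  In : Kind → Elem G → Set
  In V  (vtx _) = ⊤
  In V  (edg _) = ⊥
  In E  (vtx _) = ⊥
  In E  (edg _) = ⊤
  In VE _       = ⊤

Dominates : (G : Graph) → List (Elem G) → Kind → Set
Dominates G A W = ∀ x → In {G} W x → (x ∈ A) ⊎ (∃ λ y → (y ∈ A) × Assoc G y x)

-- A is a subset of U (as a finite set: duplicate-free list of members of U)
SubsetOf : (G : Graph) → Kind → List (Elem G) → Set
SubsetOf G U A = All (In {G} U) A × Unique A

IsGamma : (G : Graph) → Kind → Kind → ℕ → Set
IsGamma G U W k =
  (∃ λ A → SubsetOf G U A × Dominates G A W × length A ≡ k)
  × (∀ A → SubsetOf G U A → Dominates G A W → k ≤ length A)

data Reach (G : Graph) : Fin (Graph.n G) → Fin (Graph.n G) → Set where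
  here : ∀ {v} → Reach G v v
  step : ∀ {u v w} → T (Graph.adj G u v) → Reach G v w → Reach G u w

Connected : Graph → Set
Connected G = ∀ u v → Reach G u v

module Submission where

-- Every inequality γ_X ≤ |A| is obtained by turning a set A
-- that dominates some kind of elements into a set of the kind γ_X minimises,
-- without increasing its size.  Three observations suffice, all valid in any
-- graph without isolated vertices (which a connected graph on ≥ 2 vertices is):
--   * a vertex set dominating E (a vertex cover) also dominates V, and an edge
--     set dominating V (an edge cover) also dominates E;  hence both dominate
--     V ∪ E as well;
--   * replacing every vertex of a set A by an edge incident to it (the edge
--     shadow of A) preserves domination of E;
--   * replacing every edge of a set A by one of its end-vertices (the vertex
--     shadow of A) preserves domination of V.

open import Defs
open import Data.Nat using (ℕ; _≤_; z≤n; s≤s)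
open import Data.Nat.Properties using (≤-trans; ≤-reflexive)
open import Data.Product using (Σ; ∃; _×_; _,_; proj₁; proj₂)
open import Data.Product.Properties using (≡-dec)
open import Data.Sum using (_⊎_; inj₁; inj₂)
open import Data.Unit using (tt)
open import Data.Empty using (⊥-elim)
open import Data.Bool using (T)
open import Data.Bool.Properties using (T-irrelevant)
open import Data.Fin using (Fin) renaming (zero to fzero; suc to fsuc)
open import Data.Fin.Properties using (<-cmp; <-irrelevant) renaming (_≟_ to _≟ⱽ_)
open import Data.List using (List; length; map; deduplicate)
open import Data.List.Properties using (length-map; length-deduplicate)
open import Data.List.Membership.Propositional using (_∈_)
open import Data.List.Membership.Propositional.Properties using (∈-map⁺; ∈-deduplicate⁺)
open import Data.List.Relation.Unary.All as All using (All)
open import Data.List.Relation.Unary.All.Properties using () renaming (map⁺ to All-map⁺)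
open import Data.List.Relation.Unary.Unique.Propositional using (Unique)
open import Data.List.Relation.Unary.Unique.Propositional.Properties using () renaming (map⁺ to Unique-map⁺)
open import Data.List.Relation.Unary.Unique.DecPropositional.Properties using (deduplicate-!)
open import Relation.Binary.PropositionalEquality using (_≡_; _≢_; refl; cong₂; subst)
open import Relation.Binary.Definitions using (DecidableEquality; tri<; tri≈; tri>)
open import Relation.Nullary using (yes; no)

module Image {X Y : Set} (_≟_ : DecidableEquality Y) (f : X → Y) where

  image : List X → List Y
  image xs = deduplicate _≟_ (map f xs)

  length-image : ∀ xs → length (image xs) ≤ length xs
  length-image xs =
    ≤-trans (length-deduplicate _≟_ (map f xs)) (≤-reflexive (length-map f xs))

  image-unique : ∀ xs → Unique (image xs)
  image-unique xs = deduplicate-! _≟_ (map f xs)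

  ∈-image : ∀ {x xs} → x ∈ xs → f x ∈ image xs
  ∈-image x∈xs = ∈-deduplicate⁺ _≟_ (∈-map⁺ f x∈xs)

another-element : ∀ {k} (v : Fin k) → 2 ≤ k → ∃ λ w → v ≢ w
another-element fzero    (s≤s (s≤s z≤n)) = fsuc fzero , λ ()
another-element (fsuc _) (s≤s (s≤s z≤n)) = fzero , λ ()

NoIsolatedVertex : Graph → Set
NoIsolatedVertex G = ∀ v → Σ (Edge G) (EndOf G v)

module _ (G : Graph) where
  open Graph G renaming (sym to adj-sym)

  DominatedBy : List (Elem G) → Elem G → Set
  DominatedBy A x = (x ∈ A) ⊎ (∃ λ y → (y ∈ A) × Assoc G y x)

  -- Edges are equal as soon as their endpoint pairs are: the rest is proof.
  _≟ᴱ_ : DecidableEquality (Edge G)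
  _≟ᴱ_ = ≡-dec (≡-dec _≟ⱽ_ _≟ⱽ_)
               (λ p q → yes (cong₂ _,_ (<-irrelevant _ _) (T-irrelevant _ _)))

  edge-between : ∀ u v → T (adj u v) → Σ (Edge G) λ e → EndOf G u e × EndOf G v e
  edge-between u v uv with <-cmp u v
  ... | tri< u<v _ _ = ((u , v) , u<v , uv) , inj₁ refl , inj₂ refl
  ... | tri≈ _ refl _ = ⊥-elim (subst T (irrefl u) uv)
  ... | tri> _ _ v<u = ((v , u) , v<u , subst T (adj-sym u v) uv) , inj₂ refl , inj₁ refl

  ends-adjacent : ∀ {u w} e → EndOf G u e → EndOf G w e → u ≢ w → T (adj u w)
  ends-adjacent e (inj₁ refl) (inj₁ refl) u≢w = ⊥-elim (u≢w refl)
  ends-adjacent e (inj₁ refl) (inj₂ refl) _   = proj₂ (proj₂ e)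
  ends-adjacent e (inj₂ refl) (inj₁ refl) _   = subst T (adj-sym _ _) (proj₂ (proj₂ e))
  ends-adjacent e (inj₂ refl) (inj₂ refl) u≢w = ⊥-elim (u≢w refl)

  -- In a connected graph with at least two vertices, every vertex v has a
  -- neighbour: the first step of a walk from v to a vertex different from v.
  connected⇒no-isolated : 2 ≤ n → Connected G → NoIsolatedVertex G
  connected⇒no-isolated 2≤n conn v with another-element v 2≤n
  ... | w , v≢w with conn v w
  ...   | here           = ⊥-elim (v≢w refl)
  ...   | step {v = x} vx _ = let (e , v∈e , _) = edge-between v x vx in e , v∈e

  edge-near-edge : ∀ {B v f e} → EndOf G v f → EndOf G v e → edg f ∈ B →
                   DominatedBy B (edg e)
  edge-near-edge {f = f} {e} v∈f v∈e f∈B with f ≟ᴱ e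
  ... | yes refl = inj₁ f∈B
  ... | no  f≢e  = inj₂ (edg f , f∈B , ee f≢e (_ , v∈f , v∈e))

  vertex-near-vertex : ∀ {B u w} f → EndOf G u f → EndOf G w f → vtx u ∈ B →
                       DominatedBy B (vtx w)
  vertex-near-vertex {u = u} {w} f u∈f w∈f u∈B with u ≟ⱽ w
  ... | yes refl = inj₁ u∈B
  ... | no  u≢w  = inj₂ (vtx u , u∈B , vv (ends-adjacent f u∈f w∈f u≢w))

  dominates-from-VE : ∀ {A} W → Dominates G A VE → Dominates G A W
  dominates-from-VE W dom x _ = dom x tt

  dominates-VE : ∀ {A} → Dominates G A V → Dominates G A E → Dominates G A VE
  dominates-VE domV domE (vtx v) _ = domV (vtx v) tt
  dominates-VE domV domE (edg e) _ = domE (edg e) tt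

  vertex-cover : ∀ {C} → All (In {G} V) C → Dominates G C E →
                 ∀ e → ∃ λ v → vtx v ∈ C × EndOf G v e
  vertex-cover C⊆V dom e with dom (edg e) tt
  ... | inj₁ e∈C                 = ⊥-elim (All.lookup C⊆V e∈C)
  ... | inj₂ (vtx v , v∈C , ve v∈e) = v , v∈C , v∈e
  ... | inj₂ (edg f , f∈C , _)   = ⊥-elim (All.lookup C⊆V f∈C)

  edge-cover : ∀ {D} → All (In {G} E) D → Dominates G D V →
               ∀ w → ∃ λ f → edg f ∈ D × EndOf G w f
  edge-cover D⊆E dom w with dom (vtx w) tt
  ... | inj₁ w∈D                 = ⊥-elim (All.lookup D⊆E w∈D)
  ... | inj₂ (edg f , f∈D , ev w∈f) = f , f∈D , w∈f
  ... | inj₂ (vtx v , v∈D , _)   = ⊥-elim (All.lookup D⊆E v∈D)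

  -- An edge cover dominates E: the first end of any edge e lies on an edge of
  -- the cover, which equals or touches e.
  edge-cover-dominates-E : ∀ {D} → All (In {G} E) D → Dominates G D V → Dominates G D E
  edge-cover-dominates-E D⊆E dom (edg e) _ =
    let (f , f∈D , v∈f) = edge-cover D⊆E dom (proj₁ (proj₁ e))
    in edge-near-edge v∈f (inj₁ refl) f∈D

  toVertex : Elem G → Fin n
  toVertex (vtx v) = v
  toVertex (edg e) = proj₁ (proj₁ e)

  open Image _≟ⱽ_ toVertex using ()
    renaming (image to vertexImage; length-image to length-vertexImage;
              image-unique to vertexImage-unique; ∈-image to ∈-vertexImage)

  vertexShadow : List (Elem G) → List (Elem G)
  vertexShadow A = map vtx (vertexImage A)

  ∈-vertexShadow : ∀ {x A} → x ∈ A → vtx (toVertex x) ∈ vertexShadow A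
  ∈-vertexShadow x∈A = ∈-map⁺ vtx (∈-vertexImage x∈A)

  vertexShadow-dominates : ∀ {A} → Dominates G A V → Dominates G (vertexShadow A) V
  vertexShadow-dominates dom (vtx w) _ with dom (vtx w) tt
  ... | inj₁ w∈A                   = inj₁ (∈-vertexShadow w∈A)
  ... | inj₂ (vtx u , u∈A , u~w)   = inj₂ (vtx u , ∈-vertexShadow u∈A , u~w)
  ... | inj₂ (edg f , f∈A , ev w∈f) =
    vertex-near-vertex f (inj₁ refl) w∈f (∈-vertexShadow f∈A)

  vertexShadow-subset : ∀ A → SubsetOf G V (vertexShadow A)
  vertexShadow-subset A =
    All-map⁺ (All.universal (λ _ → tt) (vertexImage A)) ,
    Unique-map⁺ (λ { refl → refl }) (vertexImage-unique A)

  length-vertexShadow : ∀ A → length (vertexShadow A) ≤ length A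
  length-vertexShadow A =
    ≤-trans (≤-reflexive (length-map vtx (vertexImage A))) (length-vertexImage A)

  γ-≤ : ∀ {g A} → IsGamma G V V g → Dominates G A V → g ≤ length A
  γ-≤ {A = A} (_ , minimal) dom =
    ≤-trans (minimal _ (vertexShadow-subset A) (vertexShadow-dominates dom))
            (length-vertexShadow A)

  γ″-≤ : ∀ {g″ A} → IsGamma G VE VE g″ → Unique A → Dominates G A VE → g″ ≤ length A
  γ″-≤ {A = A} (_ , minimal) unique dom =
    minimal A (All.universal (λ _ → tt) A , unique) dom

  module WithoutIsolatedVertices (incident : NoIsolatedVertex G) where

    -- A vertex cover dominates V: every vertex w lies on an edge, and that
    -- edge has an end in the cover, equal or adjacent to w.
    vertex-cover-dominates-V : ∀ {C} → All (In {G} V) C → Dominates G C E →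
                               Dominates G C V
    vertex-cover-dominates-V C⊆V dom (vtx w) _ =
      let (f , w∈f)       = incident w
          (u , u∈C , u∈f) = vertex-cover C⊆V dom f
      in vertex-near-vertex f u∈f w∈f u∈C

    toEdge : Elem G → Edge G
    toEdge (vtx v) = proj₁ (incident v)
    toEdge (edg e) = e

    open Image _≟ᴱ_ toEdge using ()
      renaming (image to edgeImage; length-image to length-edgeImage;
                image-unique to edgeImage-unique; ∈-image to ∈-edgeImage)

    edgeShadow : List (Elem G) → List (Elem G)
    edgeShadow A = map edg (edgeImage A)

    ∈-edgeShadow : ∀ {x A} → x ∈ A → edg (toEdge x) ∈ edgeShadow A
    ∈-edgeShadow x∈A = ∈-map⁺ edg (∈-edgeImage x∈A)

    edgeShadow-dominates : ∀ {A} → Dominates G A E → Dominates G (edgeShadow A) E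
    edgeShadow-dominates dom (edg e) _ with dom (edg e) tt
    ... | inj₁ e∈A                   = inj₁ (∈-edgeShadow e∈A)
    ... | inj₂ (edg f , f∈A , f~e)   = inj₂ (edg f , ∈-edgeShadow f∈A , f~e)
    ... | inj₂ (vtx v , v∈A , ve v∈e) =
      edge-near-edge (proj₂ (incident v)) v∈e (∈-edgeShadow v∈A)

    edgeShadow-subset : ∀ A → SubsetOf G E (edgeShadow A)
    edgeShadow-subset A =
      All-map⁺ (All.universal (λ _ → tt) (edgeImage A)) ,
      Unique-map⁺ (λ { refl → refl }) (edgeImage-unique A)

    length-edgeShadow : ∀ A → length (edgeShadow A) ≤ length A
    length-edgeShadow A =
      ≤-trans (≤-reflexive (length-map edg (edgeImage A))) (length-edgeImage A)

    γ′-≤ : ∀ {g′ A} → IsGamma G E E g′ → Dominates G A E → g′ ≤ length A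
    γ′-≤ {A = A} (_ , minimal) dom =
      ≤-trans (minimal _ (edgeShadow-subset A) (edgeShadow-dominates dom))
              (length-edgeShadow A)

theorem2 : (G : Graph) → 2 ≤ Graph.n G → Connected G →
    (gVE gEV g g′ g″ : ℕ) →
    IsGamma G V E gVE → IsGamma G E V gEV → IsGamma G V V g →
    IsGamma G E E g′ → IsGamma G VE VE g″ →
    (g′ ≤ gVE × g″ ≤ gVE × g ≤ gVE ×
     g′ ≤ gEV × g″ ≤ gEV × g ≤ gEV ×
     g′ ≤ g″ × g ≤ g″)
theorem2 G 2≤n conn gVE gEV g g′ g″
  ((C , (C⊆V , C-unique) , C-dom , |C|) , _) ((D , (D⊆E , D-unique) , D-dom , |D|) , _)
  γ γ′ γ″@((A , (_ , A-unique) , A-dom , |A|) , _) =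
    at-most |C| (γ′-≤ γ′ C-dom) ,
    at-most |C| (γ″-≤ G γ″ C-unique (dominates-VE G C-dominates-V C-dom)) ,
    at-most |C| (γ-≤ G γ C-dominates-V) ,
    at-most |D| (γ′-≤ γ′ D-dominates-E) ,
    at-most |D| (γ″-≤ G γ″ D-unique (dominates-VE G D-dom D-dominates-E)) ,
    at-most |D| (γ-≤ G γ D-dom) ,
    at-most |A| (γ′-≤ γ′ (dominates-from-VE G E A-dom)) ,
    at-most |A| (γ-≤ G γ (dominates-from-VE G V A-dom))
  where
    open WithoutIsolatedVertices G (connected⇒no-isolated G 2≤n conn)
    C-dominates-V : Dominates G C V
    C-dominates-V = vertex-cover-dominates-V C⊆V C-dom
    D-dominates-E : Dominates G D E
    D-dominates-E = edge-cover-dominates-E G D⊆E D-dom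
    at-most : ∀ {k m l} → l ≡ m → k ≤ l → k ≤ m
    at-most refl k≤l = k≤l
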